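{- Let $m\ge 2$ and let $n\ge 2$ be even, and let $G_{m,n}=S_m\Box P_n$ be the stacked-book graph. Then $$im(G_{m,n}) \ge \begin{cases} m\left\lceil \frac{n}{4}\right\rceil - 1 & \text{if } n\equiv 2 \pmod 4,\\[2pt] \frac{mn}{4} & \text{if } n\equiv 0 \pmod 4.\end{cases}$$
   Context: $S_m$ is the star graph with one central vertex and $m-1$ leaves ($m$ vertices in total); $P_n$ is the path on $n$ vertices. The stacked-book graph $G_{m,n}=S_m\Box P_n$ consists of $n$ copies $S_m(1),\dots,S_m(n)$ of $S_m$, with each vertex of $S_m(i)$ joined to the corresponding vertex of $S_m(i+1)$ for $i\in[1,n-1]$. An induced matching of a graph $G$ is a set $M$ of edges such that no two edges of $M$ share an endpoint and no edge of $G$ joins an endpoint of one edge of $M$ to an endpoint of another edge of $M$; $im(G)$ is the maximum size of an induced matching of $G$. -}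

module Defs where

open import Data.Nat using (ℕ; zero; suc; _+_; _*_; _∸_; _≤_)
open import Data.Nat.DivMod using (_/_)
open import Data.Fin using (Fin; toℕ)
open import Data.Product using (_×_; _,_; proj₁; proj₂; ∃-syntax)
open import Data.Sum using (_⊎_)
open import Data.List using (List; length; lookup)
open import Data.List.Relation.Unary.All using (All)
open import Relation.Binary.PropositionalEquality using (_≡_; _≢_)
open import Relation.Nullary using (¬_)

-- Star S_m on vertex set Fin m; the central vertex is the one with index 0,
-- the other m-1 vertices are leaves.
StarAdj : {m : ℕ} → Fin m → Fin m → Set
StarAdj a b = (toℕ a ≡ 0 × toℕ b ≢ 0) ⊎ (toℕ b ≡ 0 × toℕ a ≢ 0)

PathAdj : {n : ℕ} → Fin n → Fin n → Set
PathAdj i j = (suc (toℕ i) ≡ toℕ j) ⊎ (suc (toℕ j) ≡ toℕ i)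

Vertex : ℕ → ℕ → Set
Vertex m n = Fin m × Fin n

Adj : {m n : ℕ} → Vertex m n → Vertex m n → Set
Adj (a , i) (b , j) = (i ≡ j × StarAdj a b) ⊎ (a ≡ b × PathAdj i j)

Edge : ℕ → ℕ → Set
Edge m n = Vertex m n × Vertex m n

_∈ₑ_ : {m n : ℕ} → Vertex m n → Edge m n → Set
x ∈ₑ e = (x ≡ proj₁ e) ⊎ (x ≡ proj₂ e)

-- An induced matching of G_{m,n}, given as a list of edges (listed
-- without repetition, which is forced by the disjointness condition):
-- every listed pair is an edge of G, and for two different positions
-- the edges share no endpoint and no edge of G joins their endpoints.
IsInducedMatching : {m n : ℕ} → List (Edge m n) → Set
IsInducedMatching {m} {n} M =
  All (λ e → Adj (proj₁ e) (proj₂ e)) M ×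
  (∀ (p q : Fin (length M)) → p ≢ q →
     ∀ (x y : Vertex m n) → x ∈ₑ lookup M p → y ∈ₑ lookup M q →
       x ≢ y × ¬ Adj x y)

im≥ : ℕ → ℕ → ℕ → Set
im≥ m n k = ∃[ M ] (IsInducedMatching {m} {n} M × length M ≡ k)

-- A rung of level k in column a is the vertical edge between rows 2k and 2k+1 of the
-- copy of a.  Take, at every even level, the rungs of all m-1 leaves, and at every
-- odd level the rung of the centre.  Two rungs of one level are then both leaves, so
-- they are not adjacent; rungs of consecutive levels lie in different columns, so no
-- vertical edge joins them.  With L = ⌊n/2⌋ levels this gives ⌈L/2⌉(m-1) + ⌊L/2⌋
-- edges, which is the claimed bound in both residue classes of n modulo 4.
module Submission where

open import Defs
open import Data.Nat using (ℕ; zero; suc; _+_; _*_; _∸_; _≤_; _<_; _%_; _/_; ⌊_/2⌋; ⌈_/2⌉; parity)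
open import Data.Nat.Properties
  using (<⇒≤; ≤-trans; ≤-reflexive; <-irrefl; m≤n+m; m<n⇒m<1+n; +-suc; +-comm; +-assoc; n≡⌊n+n/2⌋; n≡⌈n+n/2⌉)
open import Data.Nat.DivMod using (m≡m%n+[m/n]*n; m/n*n≤m; m*n/n≡m; *-/-assoc; +-distrib-/-∣ʳ)
open import Data.Nat.Divisibility using (_∣_; divides; m%n≡0⇒n∣m)
open import Data.Nat.Tactic.RingSolver using (solve-∀)
open import Data.Parity.Base using (Parity; 0ℙ; 1ℙ; _⁻¹)
open import Data.Parity.Properties using (p≢p⁻¹)
open import Data.Fin using (Fin; toℕ; fromℕ<) renaming (zero to fzero; suc to fsuc)
open import Data.Fin.Properties using (toℕ-fromℕ<) renaming (suc-injective to fsuc-injective)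
open import Data.Product using (_×_; _,_; proj₁; proj₂)
open import Data.Sum using (_⊎_; inj₁; inj₂)
import Data.Sum as Sum
open import Data.Empty using (⊥; ⊥-elim)
open import Data.List using (List; []; _∷_; _++_; map; length; lookup; allFin)
open import Data.List.Properties using (length-map; length-++; length-tabulate)
open import Data.List.Membership.Propositional.Properties using (∈-lookup)
open import Data.List.Relation.Unary.All using (All; []; _∷_; universal)
import Data.List.Relation.Unary.All as All
import Data.List.Relation.Unary.All.Properties as All
open import Data.List.Relation.Unary.AllPairs using (AllPairs; []; _∷_)
import Data.List.Relation.Unary.AllPairs as AllPairs
import Data.List.Relation.Unary.AllPairs.Properties as AllPairs
open import Data.List.Relation.Unary.Unique.Propositional.Properties using (allFin⁺)
open import Relation.Binary.PropositionalEquality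
  using (_≡_; _≢_; refl; sym; trans; cong; cong₂; subst; module ≡-Reasoning)
open import Relation.Nullary using (¬_)

parity-suc : ∀ k → parity (suc k) ≡ parity k ⁻¹
parity-suc zero          = refl
parity-suc (suc zero)    = refl
parity-suc (suc (suc k)) = parity-suc k

⌊1+n/2⌋≡⌊n/2⌋⊎1+⌊n/2⌋ : ∀ n → ⌊ suc n /2⌋ ≡ ⌊ n /2⌋ ⊎ ⌊ suc n /2⌋ ≡ suc ⌊ n /2⌋
⌊1+n/2⌋≡⌊n/2⌋⊎1+⌊n/2⌋ zero          = inj₁ refl
⌊1+n/2⌋≡⌊n/2⌋⊎1+⌊n/2⌋ (suc zero)    = inj₂ refl
⌊1+n/2⌋≡⌊n/2⌋⊎1+⌊n/2⌋ (suc (suc n)) = Sum.map (cong suc) (cong suc) (⌊1+n/2⌋≡⌊n/2⌋⊎1+⌊n/2⌋ n)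

[1+k*4]/4≡k : ∀ k → (1 + k * 4) / 4 ≡ k
[1+k*4]/4≡k k = trans (+-distrib-/-∣ʳ 1 {d = 4} (divides k refl)) (m*n/n≡m k 4)

Adj-sym : ∀ {m n} {x y : Vertex m n} → Adj x y → Adj y x
Adj-sym (inj₁ (eq , inj₁ s)) = inj₁ (sym eq , inj₂ s)
Adj-sym (inj₁ (eq , inj₂ s)) = inj₁ (sym eq , inj₁ s)
Adj-sym (inj₂ (eq , inj₁ s)) = inj₂ (sym eq , inj₂ s)
Adj-sym (inj₂ (eq , inj₂ s)) = inj₂ (sym eq , inj₁ s)

Separated : ∀ {m n} → Edge m n → Edge m n → Set
Separated {m} {n} e f = ∀ (x y : Vertex m n) → x ∈ₑ e → y ∈ₑ f → x ≢ y × ¬ Adj x y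

Separated-sym : ∀ {m n} (e f : Edge m n) → Separated e f → Separated f e
Separated-sym _ _ sep x y x∈f y∈e =
  (λ x≡y → proj₁ (sep y x y∈e x∈f) (sym x≡y)) , (λ adj → proj₂ (sep y x y∈e x∈f) (Adj-sym adj))

AllPairs-lookup : ∀ {A : Set} {R : A → A → Set} → (∀ {x y} → R x y → R y x) →
  ∀ {xs} → AllPairs R xs → ∀ (p q : Fin (length xs)) → p ≢ q → R (lookup xs p) (lookup xs q)
AllPairs-lookup sym (_ ∷ _)   fzero    fzero    p≢q = ⊥-elim (p≢q refl)
AllPairs-lookup sym (rx ∷ _)  fzero    (fsuc q) p≢q = All.lookup rx (∈-lookup q)
AllPairs-lookup sym (rx ∷ _)  (fsuc p) fzero    p≢q = sym (All.lookup rx (∈-lookup p))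
AllPairs-lookup sym (_ ∷ rxs) (fsuc p) (fsuc q) p≢q =
  AllPairs-lookup sym rxs p q (λ p≡q → p≢q (cong fsuc p≡q))

role : ∀ {m} → Fin m → Parity
role fzero    = 1ℙ
role (fsuc _) = 0ℙ

StarAdj⇒role≢ : ∀ {m} {a b : Fin m} → StarAdj a b → role a ≢ role b
StarAdj⇒role≢ {a = fzero}  {fzero}  (inj₁ (_ , b≢0)) = ⊥-elim (b≢0 refl)
StarAdj⇒role≢ {a = fzero}  {fzero}  (inj₂ (_ , a≢0)) = ⊥-elim (a≢0 refl)
StarAdj⇒role≢ {a = fzero}  {fsuc _} _ ()
StarAdj⇒role≢ {a = fsuc _} {fzero}  _ ()
StarAdj⇒role≢ {a = fsuc _} {fsuc _} (inj₁ (() , _))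
StarAdj⇒role≢ {a = fsuc _} {fsuc _} (inj₂ (() , _))

record Rung (m n : ℕ) : Set where
  constructor rung
  field
    column : Fin m
    level  : ℕ
    fits   : 2 + (level + level) ≤ n
    role≡parity : role column ≡ parity level
open Rung

module _ {m n : ℕ} where

  edge : Rung m n → Edge m n
  edge r = (column r , fromℕ< (<⇒≤ (fits r))) , (column r , fromℕ< (fits r))

  edge-Adj : ∀ (r : Rung m n) → Adj (proj₁ (edge r)) (proj₂ (edge r))
  edge-Adj r = inj₂ (refl , inj₁ (trans (cong suc (toℕ-fromℕ< _)) (sym (toℕ-fromℕ< _))))

  ∈-edge : ∀ {r : Rung m n} {x : Vertex m n} → x ∈ₑ edge r → proj₁ x ≡ column r × ⌊ toℕ (proj₂ x) /2⌋ ≡ level r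
  ∈-edge {r} (inj₁ refl) = refl , trans (cong ⌊_/2⌋ (toℕ-fromℕ< _)) (sym (n≡⌊n+n/2⌋ (level r)))
  ∈-edge {r} (inj₂ refl) = refl , trans (cong ⌊_/2⌋ (toℕ-fromℕ< _)) (sym (n≡⌈n+n/2⌉ (level r)))

  Apart : Rung m n → Rung m n → Set
  Apart r s = (column r , level r) ≢ (column s , level s)

  Apart-sym : ∀ (r s : Rung m n) → Apart r s → Apart s r
  Apart-sym _ _ r≉s eq = r≉s (sym eq)

  Apart⇒levels-differ : ∀ (r s : Rung m n) → Apart r s → column r ≡ column s → level r ≢ level s
  Apart⇒levels-differ _ _ r≉s cr≡cs lr≡ls = r≉s (cong₂ _,_ cr≡cs lr≡ls)

  same-level⇒same-role : ∀ (r s : Rung m n) → level r ≡ level s → role (column r) ≡ role (column s)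
  same-level⇒same-role r s lr≡ls = trans (role≡parity r) (trans (cong parity lr≡ls) (sym (role≡parity s)))

  Apart⇒¬vertical : ∀ (r s : Rung m n) → Apart r s → column r ≡ column s →
    ∀ t → ⌊ t /2⌋ ≡ level r → ⌊ suc t /2⌋ ≡ level s → ⊥
  Apart⇒¬vertical r s r≉s cr≡cs t tr ts with ⌊1+n/2⌋≡⌊n/2⌋⊎1+⌊n/2⌋ t
  ... | inj₁ same = Apart⇒levels-differ r s r≉s cr≡cs (trans (sym tr) (trans (sym same) ts))
  ... | inj₂ next = p≢p⁻¹ (parity (level r)) (begin
    parity (level r)       ≡⟨ sym (role≡parity r) ⟩
    role (column r)        ≡⟨ cong role cr≡cs ⟩
    role (column s)        ≡⟨ role≡parity s ⟩
    parity (level s)       ≡⟨ cong parity (trans (sym ts) (trans next (cong suc tr))) ⟩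
    parity (suc (level r)) ≡⟨ parity-suc (level r) ⟩
    parity (level r) ⁻¹    ∎)
    where open ≡-Reasoning

  Apart⇒Separated : ∀ (r s : Rung m n) → Apart r s → Separated (edge r) (edge s)
  Apart⇒Separated r s r≉s (a , i) (b , j) x∈r y∈s with ∈-edge {r} x∈r | ∈-edge {s} y∈s
  ... | refl , ir | refl , js = distinct , nonadjacent
    where
    distinct : (a , i) ≢ (b , j)
    distinct x≡y = Apart⇒levels-differ r s r≉s (cong proj₁ x≡y)
      (trans (sym ir) (trans (cong (λ v → ⌊ toℕ (proj₂ v) /2⌋) x≡y) js))
    nonadjacent : ¬ Adj (a , i) (b , j)
    nonadjacent (inj₁ (i≡j , star)) =
      StarAdj⇒role≢ star (same-level⇒same-role r s (trans (sym ir) (trans (cong (λ k → ⌊ toℕ k /2⌋) i≡j) js)))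
    nonadjacent (inj₂ (a≡b , inj₁ 1+i≡j)) =
      Apart⇒¬vertical r s r≉s a≡b _ ir (trans (cong ⌊_/2⌋ 1+i≡j) js)
    nonadjacent (inj₂ (a≡b , inj₂ 1+j≡i)) =
      Apart⇒¬vertical s r (Apart-sym r s r≉s) (sym a≡b) _ js (trans (cong ⌊_/2⌋ 1+j≡i) ir)

  im≥-rungs : ∀ (rs : List (Rung m n)) → AllPairs Apart rs → im≥ m n (length rs)
  im≥-rungs rs apart =
    map edge rs ,
    (All.map⁺ (universal edge-Adj rs) ,
     AllPairs-lookup (λ {e} {f} → Separated-sym e f)
       (AllPairs.map⁺ (AllPairs.map (λ {r} {s} → Apart⇒Separated r s) apart))) ,
    length-map edge rs

fits-top : ∀ {n} L → suc L + suc L ≤ n → 2 + (L + L) ≤ n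
fits-top {n} L = subst (_≤ n) (cong suc (+-suc L L))

fits-below : ∀ {n} L → suc L + suc L ≤ n → L + L ≤ n
fits-below L fits = ≤-trans (m≤n+m _ 2) (fits-top L fits)

module _ (m' n : ℕ) where

  rungsPerLevel : Parity → ℕ
  rungsPerLevel 0ℙ = m'
  rungsPerLevel 1ℙ = 1

  rungsPerLevel-alternates : ∀ p → rungsPerLevel p + rungsPerLevel (p ⁻¹) ≡ suc m'
  rungsPerLevel-alternates 0ℙ = +-comm m' 1
  rungsPerLevel-alternates 1ℙ = refl

  rungsOfParity : ∀ k → 2 + (k + k) ≤ n → ∀ p → parity k ≡ p → List (Rung (suc m') n)
  rungsOfParity k fits 0ℙ k-even = map (λ i → rung (fsuc i) k fits (sym k-even)) (allFin m')
  rungsOfParity k fits 1ℙ k-odd  = rung fzero k fits (sym k-odd) ∷ []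

  length-rungsOfParity : ∀ k fits p (eq : parity k ≡ p) →
    length (rungsOfParity k fits p eq) ≡ rungsPerLevel p
  length-rungsOfParity k fits 0ℙ _ = trans (length-map _ (allFin m')) (length-tabulate _)
  length-rungsOfParity k fits 1ℙ _ = refl

  level-rungsOfParity : ∀ k fits p (eq : parity k ≡ p) → All (λ r → level r ≡ k) (rungsOfParity k fits p eq)
  level-rungsOfParity k fits 0ℙ _ = All.map⁺ (universal (λ _ → refl) (allFin m'))
  level-rungsOfParity k fits 1ℙ _ = refl ∷ []

  apart-rungsOfParity : ∀ k fits p (eq : parity k ≡ p) → AllPairs Apart (rungsOfParity k fits p eq)
  apart-rungsOfParity k fits 0ℙ _ =
    AllPairs.map⁺ (AllPairs.map (λ i≢j same → i≢j (fsuc-injective (cong proj₁ same))) (allFin⁺ m'))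
  apart-rungsOfParity k fits 1ℙ _ = [] ∷ []

  rungsAt : ∀ k → 2 + (k + k) ≤ n → List (Rung (suc m') n)
  rungsAt k fits = rungsOfParity k fits (parity k) refl

  rungsBelow : ∀ L → L + L ≤ n → List (Rung (suc m') n)
  rungsBelow zero    _    = []
  rungsBelow (suc L) fits = rungsBelow L (fits-below L fits) ++ rungsAt L (fits-top L fits)

  level-rungsBelow : ∀ L fits → All (λ r → level r < L) (rungsBelow L fits)
  level-rungsBelow zero    _    = []
  level-rungsBelow (suc L) fits = All.++⁺
    (All.map m<n⇒m<1+n (level-rungsBelow L (fits-below L fits)))
    (All.map (λ r≡L → ≤-reflexive (cong suc r≡L)) (level-rungsOfParity L (fits-top L fits) (parity L) refl))

  apart-rungsBelow : ∀ L fits → AllPairs Apart (rungsBelow L fits)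
  apart-rungsBelow zero    _    = []
  apart-rungsBelow (suc L) fits = AllPairs.++⁺
    (apart-rungsBelow L (fits-below L fits))
    (apart-rungsOfParity L (fits-top L fits) (parity L) refl)
    (All.map (λ r<L → All.map (λ s≡L same → <-irrefl (trans (cong proj₂ same) s≡L) r<L)
                              (level-rungsOfParity L (fits-top L fits) (parity L) refl))
             (level-rungsBelow L (fits-below L fits)))

  length-rungsBelow-suc : ∀ L fits →
    length (rungsBelow (suc L) fits) ≡ length (rungsBelow L (fits-below L fits)) + rungsPerLevel (parity L)
  length-rungsBelow-suc L fits = trans (length-++ (rungsBelow L (fits-below L fits)))
    (cong (length (rungsBelow L (fits-below L fits)) +_) (length-rungsOfParity L (fits-top L fits) (parity L) refl))

  length-rungsBelow : ∀ L fits → length (rungsBelow L fits) ≡ ⌈ L /2⌉ * m' + ⌊ L /2⌋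
  length-rungsBelow zero          _    = refl
  length-rungsBelow (suc zero)    fits = trans (length-rungsBelow-suc 0 fits) (arith m')
    where
    arith : ∀ m' → 0 + m' ≡ 1 * m' + 0
    arith = solve-∀
  length-rungsBelow (suc (suc L)) fits = begin
    length (rungsBelow (2 + L) fits)
      ≡⟨ length-rungsBelow-suc (suc L) fits ⟩
    length (rungsBelow (suc L) fits′) + count (parity (suc L))
      ≡⟨ cong (_+ count (parity (suc L))) (length-rungsBelow-suc L fits′) ⟩
    length (rungsBelow L fits″) + count (parity L) + count (parity (suc L))
      ≡⟨ +-assoc (length (rungsBelow L fits″)) _ _ ⟩
    length (rungsBelow L fits″) + (count (parity L) + count (parity (suc L)))
      ≡⟨ cong₂ _+_ (length-rungsBelow L fits″) pair ⟩
    (⌈ L /2⌉ * m' + ⌊ L /2⌋) + suc m'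
      ≡⟨ arith ⌈ L /2⌉ ⌊ L /2⌋ m' ⟩
    suc ⌈ L /2⌉ * m' + suc ⌊ L /2⌋
      ∎
    where
    open ≡-Reasoning
    count = rungsPerLevel
    fits′ = fits-below (suc L) fits
    fits″ = fits-below L fits′
    pair : count (parity L) + count (parity (suc L)) ≡ suc m'
    pair = trans (cong (λ p → count (parity L) + count p) (parity-suc L)) (rungsPerLevel-alternates (parity L))
    arith : ∀ a b m' → (a * m' + b) + suc m' ≡ suc a * m' + suc b
    arith = solve-∀

  im≥-stackedBook : ∀ L → L + L ≤ n → im≥ (suc m') n (⌈ L /2⌉ * m' + ⌊ L /2⌋)
  im≥-stackedBook L fits =
    subst (im≥ (suc m') n) (length-rungsBelow L fits) (im≥-rungs (rungsBelow L fits) (apart-rungsBelow L fits))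

  im≥-rows≥4q : ∀ q → q * 4 ≤ n → im≥ (suc m') n (suc m' * q)
  im≥-rows≥4q q q*4≤n = subst (im≥ (suc m') n) size (im≥-stackedBook (q + q) (subst (_≤ n) (arith₁ q) q*4≤n))
    where
    arith₁ : ∀ q → q * 4 ≡ q + q + (q + q)
    arith₁ = solve-∀
    arith₂ : ∀ q m' → q * m' + q ≡ suc m' * q
    arith₂ = solve-∀
    size : ⌈ q + q /2⌉ * m' + ⌊ q + q /2⌋ ≡ suc m' * q
    size = trans (cong₂ (λ a b → a * m' + b) (sym (n≡⌈n+n/2⌉ q)) (sym (n≡⌊n+n/2⌋ q))) (arith₂ q m')

  im≥-rows≥4q+2 : ∀ q → 2 + q * 4 ≤ n → im≥ (suc m') n (suc m' * suc q ∸ 1)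
  im≥-rows≥4q+2 q 2+q*4≤n =
    subst (im≥ (suc m') n) size (im≥-stackedBook (suc (q + q)) (subst (_≤ n) (arith₁ q) 2+q*4≤n))
    where
    arith₁ : ∀ q → 2 + q * 4 ≡ suc (q + q) + suc (q + q)
    arith₁ = solve-∀
    arith₂ : ∀ q m' → suc q * m' + q ≡ q + m' * suc q
    arith₂ = solve-∀
    size : ⌈ suc (q + q) /2⌉ * m' + ⌊ suc (q + q) /2⌋ ≡ suc m' * suc q ∸ 1
    size = trans (cong₂ (λ a b → suc a * m' + b) (sym (n≡⌊n+n/2⌋ q)) (sym (n≡⌈n+n/2⌉ q))) (arith₂ q m')

theorem9 : (m n : ℕ) → 2 ≤ m → 2 ≤ n → 2 ∣ n →
    (n % 4 ≡ 2 → im≥ m n (m * ((n + 3) / 4) ∸ 1)) × (n % 4 ≡ 0 → im≥ m n ((m * n) / 4))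
theorem9 (suc m') n _ _ _ = n≡2[4] , n≡0[4]
  where
  q = n / 4

  n≡2[4] : n % 4 ≡ 2 → im≥ (suc m') n (suc m' * ((n + 3) / 4) ∸ 1)
  n≡2[4] r≡2 = subst (λ k → im≥ (suc m') n (suc m' * k ∸ 1)) (sym ⌈n/4⌉≡1+q)
                     (im≥-rows≥4q+2 m' n q (≤-reflexive (sym n≡2+q*4)))
    where
    n≡2+q*4 : n ≡ 2 + q * 4
    n≡2+q*4 = trans (m≡m%n+[m/n]*n n 4) (cong (_+ q * 4) r≡2)
    arith : ∀ q → 2 + q * 4 + 3 ≡ 1 + suc q * 4
    arith = solve-∀
    ⌈n/4⌉≡1+q : (n + 3) / 4 ≡ suc q
    ⌈n/4⌉≡1+q = trans (cong (λ k → (k + 3) / 4) n≡2+q*4) (trans (cong (_/ 4) (arith q)) ([1+k*4]/4≡k (suc q)))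

  n≡0[4] : n % 4 ≡ 0 → im≥ (suc m') n ((suc m' * n) / 4)
  n≡0[4] r≡0 = subst (im≥ (suc m') n) (sym (*-/-assoc (suc m') (m%n≡0⇒n∣m n 4 r≡0)))
                     (im≥-rows≥4q m' n q (m/n*n≤m n 4))
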